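{- The map $\mathbf{V}\mapsto\mathcal{V}$, sending a pseudovariety $\mathbf{V}$ of finite involution semigroups to the function assigning to each finite involutory alphabet $(A,\dagger)$ the set of languages $L\subseteq A^{+}$ recognised by some involution semigroup in $\mathbf{V}$, is injective.
   Context: Involution semigroup $(S,\star)$: $(a^\star)^\star=a$, $(ab)^\star=b^\star a^\star$; morphisms commute with involutions; a pseudovariety of finite involution semigroups is a class of finite involution semigroups closed under finite direct products (involution componentwise), sub-$\star$-semigroups and quotients. A finite involutory alphabet $(A,\dagger)$ is a finite set with a bijection $\dagger$, $(a^\dagger)^\dagger=a$, extended to words by $(a_1\cdots a_n)^\dagger=a_n^\dagger\cdots a_1^\dagger$. $(S,\star)$ recognises $L\subseteq A^{+}$ if $L=h^{ -1}(P)$ for some morphism of involution semigroups $h:(A^{+},\dagger)\to(S,\star)$ and $P\subseteq S$. -}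

module Defs where

open import Data.Nat using (ℕ)
open import Data.Fin using (Fin)
open import Data.Unit using (⊤; tt)
open import Data.Product using (Σ; _×_; _,_; proj₁; proj₂)
open import Data.List.NonEmpty using (List⁺; _⁺++⁺_; reverse; map)
open import Function.Bundles using (_↔_; _⇔_)
open import Function.Definitions using (Injective; Surjective)
open import Relation.Binary.PropositionalEquality using (_≡_; refl; cong₂)

record InvSemigroup : Set₁ where
  infixl 7 _∙_
  field
    Carrier : Set
    _∙_     : Carrier → Carrier → Carrier
    _⋆      : Carrier → Carrier
    assoc   : ∀ x y z → (x ∙ y) ∙ z ≡ x ∙ (y ∙ z)
    ⋆-invol : ∀ x → (x ⋆) ⋆ ≡ x
    ⋆-anti  : ∀ x y → (x ∙ y) ⋆ ≡ (y ⋆) ∙ (x ⋆)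

open InvSemigroup public

Finite : Set → Set
Finite X = Σ ℕ λ n → Fin n ↔ X

IsMorphism : (S T : InvSemigroup) → (Carrier S → Carrier T) → Set
IsMorphism S T f =
  (∀ x y → f (_∙_ S x y) ≡ _∙_ T (f x) (f y)) × (∀ x → f (_⋆ S x) ≡ _⋆ T (f x))

_⊗_ : InvSemigroup → InvSemigroup → InvSemigroup
S ⊗ T = record
  { Carrier = Carrier S × Carrier T
  ; _∙_ = λ p q → (_∙_ S (proj₁ p) (proj₁ q) , _∙_ T (proj₂ p) (proj₂ q))
  ; _⋆ = λ p → (_⋆ S (proj₁ p) , _⋆ T (proj₂ p))
  ; assoc = λ x y z → cong₂ _,_ (assoc S _ _ _) (assoc T _ _ _)
  ; ⋆-invol = λ x → cong₂ _,_ (⋆-invol S _) (⋆-invol T _)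
  ; ⋆-anti = λ x y → cong₂ _,_ (⋆-anti S _ _) (⋆-anti T _ _)
  }

Trivial : InvSemigroup
Trivial = record
  { Carrier = ⊤ ; _∙_ = λ _ _ → tt ; _⋆ = λ _ → tt
  ; assoc = λ _ _ _ → refl ; ⋆-invol = λ _ → refl ; ⋆-anti = λ _ _ → refl }

-- Pseudovariety of finite involution semigroups: a class (predicate) of
-- finite involution semigroups closed under finite direct products
-- (binary ones and the empty one), sub-⋆-semigroups (injective morphisms
-- into a member) and quotients (surjective morphic images of a member).
record Pseudovariety : Set₁ where
  field
    Mem      : InvSemigroup → Set
    finite   : ∀ S → Mem S → Finite (Carrier S)
    trivial  : Mem Trivial
    product  : ∀ S T → Mem S → Mem T → Mem (S ⊗ T)
    sub      : ∀ S T (f : Carrier S → Carrier T) → IsMorphism S T f →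
               Injective _≡_ _≡_ f → Mem T → Mem S
    quotient : ∀ S T (f : Carrier S → Carrier T) → IsMorphism S T f →
               Surjective _≡_ _≡_ f → Mem S → Mem T

open Pseudovariety public

record InvAlphabet : Set₁ where
  field
    Letter  : Set
    _†      : Letter → Letter
    †-invol : ∀ a → (a †) † ≡ a
    finiteA : Finite Letter

open InvAlphabet public

Word : InvAlphabet → Set
Word A = List⁺ (Letter A)

word† : (A : InvAlphabet) → Word A → Word A
word† A w = reverse (map (_† A) w)

IsWordMorphism : (A : InvAlphabet) (S : InvSemigroup) → (Word A → Carrier S) → Set
IsWordMorphism A S h =
  (∀ u v → h (u ⁺++⁺ v) ≡ _∙_ S (h u) (h v)) × (∀ w → h (word† A w) ≡ _⋆ S (h w))

Language : InvAlphabet → Set₁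
Language A = Word A → Set

Recognises : (S : InvSemigroup) (A : InvAlphabet) → Language A → Set₁
Recognises S A L =
  Σ (Word A → Carrier S) λ h → IsWordMorphism A S h ×
  Σ (Carrier S → Set) λ P → ∀ w → L w ⇔ P (h w)

Languages : Pseudovariety → (A : InvAlphabet) → Language A → Set₁
Languages V A L = Σ InvSemigroup λ S → Mem V S × Recognises S A L

module Submission where

-- If 𝒱 ⊆ 𝒲 and S ∈ V, read S itself as an involutory alphabet and let
-- h : S⁺ → S be the evaluation morphism. Each fibre h⁻¹(s) is recognised
-- by S, hence by some T_s ∈ W through a morphism g_s. The product T of the
-- T_s lies in W, and the tuple g = (g_s)ₛ satisfies ker g ⊆ ker h. So S is a
-- morphic image of the sub-⋆-semigroup g(S⁺) of T, and lies in W.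
-- Constructively, g(S⁺) is represented by the words that are the first of
-- their g-class in an enumeration of S⁺; finiteness of T makes that
-- first word computable.

open import Axiom.UniquenessOfIdentityProofs.WithK using (uip)
open import Data.Fin as Fin using (Fin; toℕ)
open import Data.Fin.Properties using (toℕ-injective; toℕ-fromℕ<; toℕ<n)
open import Data.List as List using (List; []; _∷_)
import Data.List.Properties as List
open import Data.List.NonEmpty as List⁺
  using (List⁺; _∷_; _∷⁺_; _⁺++⁺_; [_]; toList)
open import Data.List.NonEmpty.Properties using (∷→∷⁺; toList-⁺++⁺)
open import Data.Nat using (ℕ; zero; suc; _+_; _*_; _<_; _≤_; s≤s; NonZero)
open import Data.Nat.DivMod
open import Data.Nat.Divisibility using (divides-refl)
open import Data.Nat.Properties
open import Data.Product using (Σ; ∃; _×_; _,_; proj₁; proj₂)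
open import Data.Product.Properties using (Σ-≡,≡→≡)
open import Data.Sum using (_⊎_; inj₁; inj₂; [_,_]′)
open import Data.Unit using (tt)
import Data.Vec as Vec
import Data.Vec.Properties as Vec
open import Defs
open import Function using (_∘_; id; case_of_)
open import Function.Bundles using (_↔_; _⇔_; Inverse; Equivalence; mk⇔)
open import Function.Consequences.Propositional using (strictlySurjective⇒surjective)
open import Function.Definitions using (Injective; Surjective)
open import Function.Properties.Inverse using (↔-sym; ↔⇒↣)
open import Relation.Binary using (DecidableEquality; tri<; tri≈; tri>)
open import Relation.Binary.PropositionalEquality hiding ([_])
open import Relation.Nullary using (yes; no; ¬_; contradiction)
open import Relation.Nullary.Decidable using (via-injection)
open import Relation.Unary using (Decidable)

open ≡-Reasoning

Least : (ℕ → Set) → ℕ → Set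
Least Q n = Q n × (∀ {j} → j < n → ¬ Q j)

least-unique : ∀ {Q m n} → Least Q m → Least Q n → m ≡ n
least-unique {m = m} {n} (Qm , below-m) (Qn , below-n) with <-cmp m n
... | tri< m<n _ _ = contradiction Qm (below-n m<n)
... | tri≈ _ m≡n _ = m≡n
... | tri> _ _ n<m = contradiction Qn (below-m n<m)

module _ {Q : ℕ → Set} (Q? : Decidable Q) where

  none-below⊎least : ∀ n → (∀ {j} → j < n → ¬ Q j) ⊎ ∃ (Least Q)
  none-below⊎least zero = inj₁ λ ()
  none-below⊎least (suc n) with none-below⊎least n
  ... | inj₂ found = inj₂ found
  ... | inj₁ none with Q? n
  ...   | yes Qn = inj₂ (n , Qn , none)
  ...   | no ¬Qn = inj₁ λ j<1+n →
            [ none , (λ { refl → ¬Qn }) ]′ (m<1+n⇒m<n∨m≡n j<1+n)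

  least : ∀ {n} → Q n → ∃ (Least Q)
  least {n} Qn with none-below⊎least (suc n)
  ... | inj₁ none  = contradiction Qn (none (n<1+n n))
  ... | inj₂ found = found

Enumeration : Set → Set
Enumeration X = Σ (ℕ → X) λ at → ∀ x → ∃ λ n → at n ≡ x

finite⇒decidableEquality : ∀ {X} → Finite X → DecidableEquality X
finite⇒decidableEquality (_ , Fin↔X) = via-injection (↔⇒↣ (↔-sym Fin↔X)) Fin._≟_

module Numeration (m : ℕ) .{{_ : NonZero m}} where

  encode : List (Fin m) → ℕ
  encode []       = 0
  encode (x ∷ xs) = suc (toℕ x + encode xs * m)

  decodeWithin : ℕ → ℕ → List (Fin m)
  decodeWithin zero    _       = []
  decodeWithin (suc f) zero    = []
  decodeWithin (suc f) (suc n) = n mod m ∷ decodeWithin f (n / m)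

  decode : ℕ → List (Fin m)
  decode n = decodeWithin n n

  digit-mod : ∀ x c → (toℕ x + c * m) mod m ≡ x
  digit-mod x c = toℕ-injective (begin
    toℕ ((toℕ x + c * m) mod m) ≡⟨ toℕ-fromℕ< (m%n<n (toℕ x + c * m) m) ⟩
    (toℕ x + c * m) % m         ≡⟨ [m+kn]%n≡m%n (toℕ x) c m ⟩
    toℕ x % m                   ≡⟨ m<n⇒m%n≡m (toℕ<n x) ⟩
    toℕ x                       ∎)

  digit-div : ∀ x c → (toℕ x + c * m) / m ≡ c
  digit-div x c = begin
    (toℕ x + c * m) / m   ≡⟨ +-distrib-/-∣ʳ (toℕ x) (divides-refl c) ⟩
    toℕ x / m + c * m / m ≡⟨ cong₂ _+_ (m<n⇒m/n≡0 (toℕ<n x)) (m*n/n≡m c m) ⟩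
    c                     ∎

  decodeWithin-encode : ∀ xs {f} → encode xs ≤ f → decodeWithin f (encode xs) ≡ xs
  decodeWithin-encode []       {zero}  _          = refl
  decodeWithin-encode []       {suc f} _          = refl
  decodeWithin-encode (x ∷ xs) {suc f} (s≤s c′≤f) = cong₂ _∷_ (digit-mod x c)
    (trans (cong (decodeWithin f) (digit-div x c)) (decodeWithin-encode xs c≤f))
    where
    c = encode xs
    c≤f : c ≤ f
    c≤f = ≤-trans (≤-trans (m≤m*n c m) (m≤n+m (c * m) (toℕ x))) c′≤f

  decode-encode : ∀ xs → decode (encode xs) ≡ xs
  decode-encode xs = decodeWithin-encode xs ≤-refl

nonEmptyOr : {X : Set} → X → List X → List⁺ X
nonEmptyOr d []       = [ d ]
nonEmptyOr d (x ∷ xs) = x ∷ xs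

List⁺-enumeration : ∀ {X : Set} {k} → Fin (suc k) ↔ X → Enumeration (List⁺ X)
List⁺-enumeration {X} {k} Fin↔X = at , λ w → encode (List.map from (toList w)) , at-encode w
  where
  open Inverse Fin↔X
  open Numeration (suc k)

  at : ℕ → List⁺ X
  at n = nonEmptyOr (to Fin.zero) (List.map to (decode n))

  at-encode : ∀ w → at (encode (List.map from (toList w))) ≡ w
  at-encode (x ∷ xs) = cong (nonEmptyOr (to Fin.zero)) (begin
    List.map to (decode (encode (List.map from (x ∷ xs))))
      ≡⟨ cong (List.map to) (decode-encode (List.map from (x ∷ xs))) ⟩
    List.map to (List.map from (x ∷ xs)) ≡⟨ List.map-∘ (x ∷ xs) ⟨
    List.map (to ∘ from) (x ∷ xs)        ≡⟨ List.map-cong strictlyInverseˡ (x ∷ xs) ⟩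
    List.map id (x ∷ xs)                 ≡⟨ List.map-id (x ∷ xs) ⟩
    x ∷ xs                               ∎)

module NormalForm {X Y : Set} (enumeration : Enumeration X)
                  (_≟_ : DecidableEquality Y) (g : X → Y) where

  private
    at : ℕ → X
    at = proj₁ enumeration

    Hits : Y → ℕ → Set
    Hits y n = g (at n) ≡ y

    firstHit : ∀ x → ∃ (Least (Hits (g x)))
    firstHit x = least (λ n → g (at n) ≟ g x) (cong g (proj₂ (proj₂ enumeration x)))

  nf : X → X
  nf x = at (proj₁ (firstHit x))

  g-nf : ∀ x → g (nf x) ≡ g x
  g-nf x = proj₁ (proj₂ (firstHit x))

  nf-cong : ∀ {x y} → g x ≡ g y → nf x ≡ nf y
  nf-cong {x} {y} gx≡gy = cong at (least-unique
    (subst (λ z → Least (Hits z) (proj₁ (firstHit x))) gx≡gy (proj₂ (firstHit x)))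
    (proj₂ (firstHit y)))

  nf-idem : ∀ x → nf (nf x) ≡ nf x
  nf-idem x = nf-cong (g-nf x)

module Induced (T : InvSemigroup) {X : Set} (_·_ : X → X → X) (_* : X → X)
               {ι : X → Carrier T} (ι-injective : Injective _≡_ _≡_ ι)
               (ι-· : ∀ x y → ι (x · y) ≡ _∙_ T (ι x) (ι y))
               (ι-* : ∀ x → ι (x *) ≡ _⋆ T (ι x)) where

  open InvSemigroup T using () renaming (_∙_ to _∙ᵀ_; _⋆ to _⋆ᵀ)

  induced : InvSemigroup
  induced = record
    { Carrier = X ; _∙_ = _·_ ; _⋆ = _*
    ; assoc   = λ x y z → ι-injective (begin
        ι ((x · y) · z)      ≡⟨ ι-· (x · y) z ⟩
        ι (x · y) ∙ᵀ ι z     ≡⟨ cong (_∙ᵀ ι z) (ι-· x y) ⟩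
        (ι x ∙ᵀ ι y) ∙ᵀ ι z  ≡⟨ assoc T (ι x) (ι y) (ι z) ⟩
        ι x ∙ᵀ (ι y ∙ᵀ ι z)  ≡⟨ cong (ι x ∙ᵀ_) (ι-· y z) ⟨
        ι x ∙ᵀ ι (y · z)     ≡⟨ ι-· x (y · z) ⟨
        ι (x · (y · z))      ∎)
    ; ⋆-invol = λ x → ι-injective (begin
        ι ((x *) *)  ≡⟨ ι-* (x *) ⟩
        ι (x *) ⋆ᵀ   ≡⟨ cong _⋆ᵀ (ι-* x) ⟩
        (ι x ⋆ᵀ) ⋆ᵀ  ≡⟨ ⋆-invol T (ι x) ⟩
        ι x          ∎)
    ; ⋆-anti  = λ x y → ι-injective (begin
        ι ((x · y) *)         ≡⟨ ι-* (x · y) ⟩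
        ι (x · y) ⋆ᵀ          ≡⟨ cong _⋆ᵀ (ι-· x y) ⟩
        (ι x ∙ᵀ ι y) ⋆ᵀ       ≡⟨ ⋆-anti T (ι x) (ι y) ⟩
        (ι y ⋆ᵀ) ∙ᵀ (ι x ⋆ᵀ)  ≡⟨ cong₂ _∙ᵀ_ (ι-* y) (ι-* x) ⟨
        ι (y *) ∙ᵀ ι (x *)    ≡⟨ ι-· (y *) (x *) ⟨
        ι ((y *) · (x *))     ∎)
    }

  ι-morphism : IsMorphism induced T ι
  ι-morphism = ι-· , ι-*

module Image {A : InvAlphabet} {T : InvSemigroup} (words : Enumeration (Word A))
             (_≟_ : DecidableEquality (Carrier T))
             {g : Word A → Carrier T} (g-morphism : IsWordMorphism A T g) where

  open NormalForm words _≟_ g public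

  -- With K the proof of nf w ≡ w is unique, so NormalWord is a subset of the words.
  NormalWord : Set
  NormalWord = Σ (Word A) λ w → nf w ≡ w

  normal : Word A → NormalWord
  normal w = nf w , nf-idem w

  ι : NormalWord → Carrier T
  ι = g ∘ proj₁

  ι-injective : Injective _≡_ _≡_ ι
  ι-injective {u , nf-u} {v , nf-v} gu≡gv =
    Σ-≡,≡→≡ (trans (sym nf-u) (trans (nf-cong gu≡gv) nf-v) , uip _ _)

  open Induced T (λ u v → normal (proj₁ u ⁺++⁺ proj₁ v)) (λ u → normal (word† A (proj₁ u)))
    ι-injective (λ u v → trans (g-nf _) (proj₁ g-morphism (proj₁ u) (proj₁ v)))
    (λ u → trans (g-nf _) (proj₂ g-morphism (proj₁ u)))
    public renaming (induced to image)

mem-of-divisor : (W : Pseudovariety) {A : InvAlphabet} {S T : InvSemigroup} →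
                 Enumeration (Word A) →
                 {g : Word A → Carrier T} → IsWordMorphism A T g →
                 {h : Word A → Carrier S} → IsWordMorphism A S h →
                 (∀ s → ∃ λ w → h w ≡ s) →
                 (∀ {u v} → g u ≡ g v → h u ≡ h v) →
                 Mem W T → Mem W S
mem-of-divisor W {A} {S} {T} words {g} g-morphism {h} h-morphism h-onto ker-g⊆ker-h T∈W =
  quotient W image S π π-morphism π-surjective
    (sub W image T ι ι-morphism ι-injective T∈W)
  where
  open Image {A} {T} words (finite⇒decidableEquality (finite W T T∈W)) {g} g-morphism

  h-nf : ∀ w → h (nf w) ≡ h w
  h-nf w = ker-g⊆ker-h (g-nf w)

  π : NormalWord → Carrier S
  π = h ∘ proj₁

  π-morphism : IsMorphism image S π
  π-morphism = (λ u v → trans (h-nf _) (proj₁ h-morphism (proj₁ u) (proj₁ v)))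
             , (λ u → trans (h-nf _) (proj₂ h-morphism (proj₁ u)))

  π-surjective : Surjective _≡_ _≡_ π
  π-surjective = strictlySurjective⇒surjective λ s →
    normal (proj₁ (h-onto s)) , trans (h-nf _) (proj₂ (h-onto s))

toList∘fromVec : {X : Set} {n : ℕ} (v : Vec.Vec X (suc n)) →
                toList (List⁺.fromVec v) ≡ Vec.toList v
toList∘fromVec (x Vec.∷ xs) = refl

toList-injective⁺ : {X : Set} {u v : List⁺ X} → toList u ≡ toList v → u ≡ v
toList-injective⁺ {u = _ ∷ _} {_ ∷ _} = ∷→∷⁺

toList-reverse⁺ : {X : Set} (w : List⁺ X) → toList (List⁺.reverse w) ≡ List.reverse (toList w)
toList-reverse⁺ {X} (x ∷ xs) = begin
  toList (List⁺.fromVec (Vec.reverse v))          ≡⟨ toList∘fromVec (Vec.reverse v) ⟩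
  Vec.toList (Vec.reverse v)                      ≡⟨ Vec.toList-reverse v ⟩
  List.reverse (x ∷ Vec.toList (Vec.fromList xs)) ≡⟨ cong (List.reverse ∘ (x ∷_)) (Vec.toList∘fromList xs) ⟩
  List.reverse (x ∷ xs)                           ∎
  where
  v : Vec.Vec X (suc (List.length xs))
  v = x Vec.∷ Vec.fromList xs

reverse-∷⁺ : {X : Set} (x : X) (w : List⁺ X) →
             List⁺.reverse (x ∷⁺ w) ≡ List⁺.reverse w ⁺++⁺ [ x ]
reverse-∷⁺ x w = toList-injective⁺ (begin
  toList (List⁺.reverse (x ∷⁺ w))         ≡⟨ toList-reverse⁺ (x ∷⁺ w) ⟩
  List.reverse (x ∷ toList w)             ≡⟨ List.unfold-reverse x (toList w) ⟩
  List.reverse (toList w) List.∷ʳ x       ≡⟨ cong (List._∷ʳ x) (toList-reverse⁺ w) ⟨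
  toList (List⁺.reverse w) List.∷ʳ x      ≡⟨ toList-⁺++⁺ (List⁺.reverse w) [ x ] ⟩
  toList (List⁺.reverse w ⁺++⁺ [ x ])     ∎)

module Evaluation {A : InvAlphabet} (S : InvSemigroup) (f : Letter A → Carrier S)
                  (f-† : ∀ a → f (_† A a) ≡ _⋆ S (f a)) where

  open InvSemigroup S using () renaming (_∙_ to _·_; _⋆ to _*)

  evalFrom : Letter A → List (Letter A) → Carrier S
  evalFrom a []       = f a
  evalFrom a (b ∷ bs) = f a · evalFrom b bs

  eval : Word A → Carrier S
  eval (a ∷ as) = evalFrom a as

  evalFrom-++ : ∀ a as b bs → evalFrom a (as List.++ b ∷ bs) ≡ evalFrom a as · evalFrom b bs
  evalFrom-++ a []       b bs = refl
  evalFrom-++ a (c ∷ cs) b bs = begin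
    f a · evalFrom c (cs List.++ b ∷ bs)    ≡⟨ cong (f a ·_) (evalFrom-++ c cs b bs) ⟩
    f a · (evalFrom c cs · evalFrom b bs)   ≡⟨ assoc S (f a) _ _ ⟨
    (f a · evalFrom c cs) · evalFrom b bs   ∎

  eval-⁺++⁺ : ∀ u v → eval (u ⁺++⁺ v) ≡ eval u · eval v
  eval-⁺++⁺ (a ∷ as) (b ∷ bs) = evalFrom-++ a as b bs

  evalFrom-word† : ∀ a as → eval (word† A (a ∷ as)) ≡ evalFrom a as *
  evalFrom-word† a []       = f-† a
  evalFrom-word† a (b ∷ bs) = begin
    eval (word† A (a ∷⁺ (b ∷ bs)))            ≡⟨ cong eval (reverse-∷⁺ (_† A a) (List⁺.map (_† A) (b ∷ bs))) ⟩
    eval (word† A (b ∷ bs) ⁺++⁺ [ _† A a ])   ≡⟨ eval-⁺++⁺ (word† A (b ∷ bs)) [ _† A a ] ⟩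
    eval (word† A (b ∷ bs)) · f (_† A a)      ≡⟨ cong₂ _·_ (evalFrom-word† b bs) (f-† a) ⟩
    (evalFrom b bs *) · (f a *)               ≡⟨ ⋆-anti S (f a) (evalFrom b bs) ⟨
    (f a · evalFrom b bs) *                   ∎

  eval-morphism : IsWordMorphism A S eval
  eval-morphism = eval-⁺++⁺ , λ { (a ∷ as) → evalFrom-word† a as }

⨂ : ∀ {n} → (Fin n → InvSemigroup) → InvSemigroup
⨂ {zero}  F = Trivial
⨂ {suc n} F = F Fin.zero ⊗ ⨂ (F ∘ Fin.suc)

⨂-mem : (W : Pseudovariety) → ∀ {n} {F : Fin n → InvSemigroup} →
        (∀ i → Mem W (F i)) → Mem W (⨂ F)
⨂-mem W {zero}      F∈W = trivial W
⨂-mem W {suc n} {F} F∈W = product W _ _ (F∈W Fin.zero) (⨂-mem W (F∈W ∘ Fin.suc))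

module _ {X : Set} where

  tuple : ∀ {n} (F : Fin n → InvSemigroup) → (∀ i → X → Carrier (F i)) → X → Carrier (⨂ F)
  tuple {zero}  F g x = tt
  tuple {suc n} F g x = g Fin.zero x , tuple (F ∘ Fin.suc) (g ∘ Fin.suc) x

  tuple-component : ∀ {n} (F : Fin n → InvSemigroup) (g : ∀ i → X → Carrier (F i)) i {x y} →
                    tuple F g x ≡ tuple F g y → g i x ≡ g i y
  tuple-component F g Fin.zero    eq = cong proj₁ eq
  tuple-component F g (Fin.suc i) eq =
    tuple-component (F ∘ Fin.suc) (g ∘ Fin.suc) i (cong proj₂ eq)

tuple-morphism : ∀ {A n} (F : Fin n → InvSemigroup) {g : ∀ i → Word A → Carrier (F i)} →
                 (∀ i → IsWordMorphism A (F i) (g i)) → IsWordMorphism A (⨂ F) (tuple F g)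
tuple-morphism {n = zero}  F g-morphism = (λ _ _ → refl) , (λ _ → refl)
tuple-morphism {A} {suc n} F {g} g-morphism =
    (λ u v → cong₂ _,_ (proj₁ (g-morphism Fin.zero) u v) (proj₁ rest u v))
  , (λ w → cong₂ _,_ (proj₂ (g-morphism Fin.zero) w) (proj₂ rest w))
  where
  rest : IsWordMorphism A (⨂ (F ∘ Fin.suc)) (tuple (F ∘ Fin.suc) (g ∘ Fin.suc))
  rest = tuple-morphism {A} (F ∘ Fin.suc) {g ∘ Fin.suc} (g-morphism ∘ Fin.suc)

mem-of-empty : (W : Pseudovariety) (S : InvSemigroup) → ¬ Carrier S → Mem W S
mem-of-empty W S empty = sub W S Trivial _ ((λ _ _ → refl) , (λ _ → refl))
  (λ {x} _ → contradiction x empty) (trivial W)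

recognised-saturated : ∀ {T A L} (r : Recognises T A L) {u v} →
                       proj₁ r u ≡ proj₁ r v → L u → L v
recognised-saturated (_ , _ , P , L⇔P) gu≡gv Lu =
  Equivalence.from (L⇔P _) (subst P gu≡gv (Equivalence.to (L⇔P _) Lu))

alphabet : (S : InvSemigroup) → Finite (Carrier S) → InvAlphabet
alphabet S S-finite = record
  { Letter = Carrier S ; _† = _⋆ S ; †-invol = ⋆-invol S ; finiteA = S-finite }

languages⊆⇒mem⊆-nonempty : (V W : Pseudovariety) →
                            (∀ A L → Languages V A L → Languages W A L) →
                            ∀ {k} (S : InvSemigroup) → Fin (suc k) ↔ Carrier S → Mem V S → Mem W S
languages⊆⇒mem⊆-nonempty V W 𝒱⊆𝒲 {k} S Fin↔S S∈V =
  mem-of-divisor W {A} {S} {⨂ T} (List⁺-enumeration Fin↔S) (tuple-morphism {A} T g-morphism)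
    eval-morphism (λ s → [ s ] , refl) ker-tuple⊆ker-eval (⨂-mem W T∈W)
  where
  open Inverse Fin↔S
  A : InvAlphabet
  A = alphabet S (suc k , Fin↔S)
  open Evaluation {A} S id (λ _ → refl)

  fibre : Carrier S → Language A
  fibre s w = eval w ≡ s

  recognisedInW : ∀ i → Languages W A (fibre (to i))
  recognisedInW i = 𝒱⊆𝒲 A (fibre (to i))
    (S , S∈V , eval , eval-morphism , (_≡ to i) , λ _ → mk⇔ id id)

  T : Fin (suc k) → InvSemigroup
  T i = proj₁ (recognisedInW i)

  T∈W : ∀ i → Mem W (T i)
  T∈W i = proj₁ (proj₂ (recognisedInW i))

  recognition : ∀ i → Recognises (T i) A (fibre (to i))
  recognition i = proj₂ (proj₂ (recognisedInW i))

  g : ∀ i → Word A → Carrier (T i)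
  g i = proj₁ (recognition i)

  g-morphism : ∀ i → IsWordMorphism A (T i) (g i)
  g-morphism i = proj₁ (proj₂ (recognition i))

  ker-tuple⊆ker-eval : ∀ {u v} → tuple T g u ≡ tuple T g v → eval u ≡ eval v
  ker-tuple⊆ker-eval {u} {v} gu≡gv = begin
    eval u ≡⟨ strictlyInverseˡ (eval u) ⟨
    to i   ≡⟨ recognised-saturated {T i} {A} {fibre (to i)} (recognition i)
                (tuple-component T g i gu≡gv) (sym (strictlyInverseˡ (eval u))) ⟨
    eval v ∎
    where
    i = from (eval u)

languages⊆⇒mem⊆ : (V W : Pseudovariety) →
                   (∀ A L → Languages V A L → Languages W A L) →
                   ∀ S → Mem V S → Mem W S
languages⊆⇒mem⊆ V W 𝒱⊆𝒲 S S∈V with finite V S S∈V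
... | zero  , Fin↔S = mem-of-empty W S λ s → case Inverse.from Fin↔S s of λ ()
... | suc k , Fin↔S = languages⊆⇒mem⊆-nonempty V W 𝒱⊆𝒲 S Fin↔S S∈V

lemma9 : (V W : Pseudovariety) →
         (∀ (A : InvAlphabet) (L : Language A) → Languages V A L ⇔ Languages W A L) →
         ∀ (S : InvSemigroup) → Mem V S ⇔ Mem W S
lemma9 V W 𝒱≡𝒲 S = mk⇔
  (languages⊆⇒mem⊆ V W (λ A L → Equivalence.to (𝒱≡𝒲 A L)) S)
  (languages⊆⇒mem⊆ W V (λ A L → Equivalence.from (𝒱≡𝒲 A L)) S)
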